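{- For integers $n\geq 2$ and $k\geq 1$, $$HM_{n,k}=\sum_{m=2k-1}^{n-1}MP_{m,2k-1},\qquad MP_{n,2k}=HM_{n,k}+HM_{n,k+1}.$$
   Context: A Motzkin path of order $n$ is a lattice path from $(0,0)$ to $(n,0)$ using up steps $U=(1,1)$, down steps $D=(1,-1)$ and flat steps $F=(1,0)$ that never goes below the $x$-axis. A hump is a consecutive sequence of steps of a Motzkin path consisting of an up step, followed by zero or more flat steps, followed by a down step; its height is the $y$-coordinate reached by its up step. $HM_{n,k}$ is the number of pairs $(M,P)$ with $M$ a Motzkin path of order $n$ and $P$ a hump of $M$ of height $k$. A Motzkin prefix is a lattice path that is a prefix of a Motzkin path (a path from $(0,0)$ with steps $U,D,F$ never going below the $x$-axis), and $MP_{n,k}$ is the number of Motzkin prefixes from $(0,0)$ to $(n,k)$. -}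

module Defs where

open import Data.Nat using (ℕ; zero; suc; _+_; _∸_; _≟_)
open import Data.Bool using (Bool; true; false; if_then_else_)
open import Data.List using (List; []; _∷_; _++_; map; concatMap; length; filter; upTo)
open import Data.Nat.ListAction using (sum)
open import Data.Maybe using (Maybe; just; nothing)
open import Data.Maybe.Properties using (≡-dec)
open import Relation.Binary.PropositionalEquality using (_≡_)

-- Steps of a lattice path: U = (1,1), D = (1,-1), F = (1,0)
data Step : Set where
  U D F : Step

words : ℕ → List (List Step)
words zero    = [] ∷ []
words (suc n) = concatMap (λ w → (U ∷ w) ∷ (D ∷ w) ∷ (F ∷ w) ∷ []) (words n)

walk : ℕ → List Step → Maybe ℕ
walk h       []      = just h
walk h       (U ∷ w) = walk (suc h) w
walk zero    (D ∷ w) = nothing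
walk (suc h) (D ∷ w) = walk h w
walk h       (F ∷ w) = walk h w

MP : ℕ → ℕ → ℕ
MP n k = length (filter (λ w → ≡-dec _≟_ (walk 0 w) (just k)) (words n))

motzkin : ℕ → List (List Step)
motzkin n = filter (λ w → ≡-dec _≟_ (walk 0 w) (just 0)) (words n)

closes : List Step → Bool
closes (F ∷ w) = closes w
closes (D ∷ w) = true
closes _       = false

-- humps h w : list of the heights of all humps of w (one entry per hump,
-- a hump being identified by its up step), when w starts at height h.
humps : ℕ → List Step → List ℕ
humps h []      = []
humps h (U ∷ w) = (if closes w then suc h ∷ [] else []) ++ humps (suc h) w
humps h (D ∷ w) = humps (h ∸ 1) w
humps h (F ∷ w) = humps h w

count : ℕ → List ℕ → ℕ
count k xs = length (filter (λ x → x ≟ k) xs)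

HM : ℕ → ℕ → ℕ
HM n k = sum (map (λ M → count k (humps 0 M)) (motzkin n))

-- sumFromTo a b f = f a + f (a+1) + ... + f b  (0 if b < a)
sumFromTo : ℕ → ℕ → (ℕ → ℕ) → ℕ
sumFromTo a b f = sum (map (λ i → f (a + i)) (upTo (suc b ∸ a)))

{-# OPTIONS --safe #-}
-- Let walks h n k count nonnegative U/D/F walks of length n from height h to height k, so that
-- MP n k = walks 0 n k. Its first-step recursion sums over the neighbours of h; exchanging the
-- order of summation yields the same recursion on the last step, hence the reversal symmetry
-- walks h n k = walks k n h.
--
-- Classifying the words of length n by their first step, the number of (path, hump of height
-- c + 1) pairs obeys the same recursion plus a source term: the up step of a hump at height c + 1,
-- followed by flat steps, a down step and a walk from c to 0. By the discrete Duhamel principle the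
-- hump count is therefore a Cauchy product of walks 0 → c with partial sums of walks c → 0.
-- Reversing the first factor, a term of the product is a walk from 2c + 1 to 0 cut at its first
-- step from c + 1 to c; by symmetry, HM n (c + 1) = ∑_{m<n} MP m (2c + 1), and the terms with
-- m < 2c + 1 vanish. Finally MP n (2c + 2) telescopes over its last step: the flat steps cancel,
-- leaving the arrivals from 2c + 3 and 2c + 1, which are HM n (c + 2) and HM n (c + 1).
module Submission where

open import Defs
open import Data.Nat using (ℕ; zero; suc; _≤_; _<_; z≤n; s≤s; _*_; _+_; _∸_; _≟_; _≡ᵇ_)
open import Data.Product using (_×_; _,_)
open import Data.Nat.Properties
  using (+-comm; +-assoc; +-identityʳ; +-suc; *-comm; *-zeroʳ; *-distribˡ-+;
         ≤-refl; ≤-<-trans; <⇒≢; n≤1+n; m≤n⇒m≤1+n; +-monoˡ-≤; +-commutativeSemigroup)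
open import Algebra.Properties.CommutativeSemigroup +-commutativeSemigroup
  using (interchange; x∙yz≈y∙xz; x∙yz≈xz∙y; x∙yz≈z∙xy; xy∙z≈xz∙y)
open import Data.Bool using (true; false; if_then_else_)
open import Data.List using (List; []; _∷_; _++_; map; concatMap; length; filter; upTo)
open import Data.List.Properties using (map-cong; map-++; map-applyUpTo; map-upTo; upTo-∷ʳ)
open import Data.Nat.ListAction using (sum)
open import Data.Nat.ListAction.Properties using (sum-++)
open import Data.Maybe using (just)
open import Data.Maybe.Properties using (≡-dec)
open import Relation.Nullary using (Dec; does; ¬_; contradiction)
open import Relation.Binary.PropositionalEquality
  using (_≡_; refl; sym; trans; cong; cong₂; subst; subst₂; module ≡-Reasoning)
open import Function using (_∘_)

open ≡-Reasoning

private variable A B : Set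

⟦_⟧ : {P : Set} → Dec P → ℕ
⟦ d ⟧ = if does d then 1 else 0

δ : ℕ → ℕ → ℕ
δ h k = ⟦ h ≟ k ⟧

δ-sym : ∀ h k → δ h k ≡ δ k h
δ-sym zero    zero    = refl
δ-sym zero    (suc k) = refl
δ-sym (suc h) zero    = refl
δ-sym (suc h) (suc k) = δ-sym h k

δ-≢ : ∀ h k → ¬ h ≡ k → δ h k ≡ 0
δ-≢ zero    zero    h≢k = contradiction refl h≢k
δ-≢ zero    (suc k) h≢k = refl
δ-≢ (suc h) zero    h≢k = refl
δ-≢ (suc h) (suc k) h≢k = δ-≢ h k (h≢k ∘ cong suc)

δ-subst : ∀ h k (f : ℕ → ℕ) → δ h k * f h ≡ δ h k * f k
δ-subst zero    zero    f = refl
δ-subst zero    (suc k) f = refl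
δ-subst (suc h) zero    f = refl
δ-subst (suc h) (suc k) f = δ-subst h k (f ∘ suc)

-- Finite sums

sum-map-zero : (xs : List A) → sum (map (λ _ → 0) xs) ≡ 0
sum-map-zero []       = refl
sum-map-zero (x ∷ xs) = sum-map-zero xs

sum-map-+ : (f g : A → ℕ) (xs : List A) →
            sum (map (λ x → f x + g x) xs) ≡ sum (map f xs) + sum (map g xs)
sum-map-+ f g []       = refl
sum-map-+ f g (x ∷ xs) =
  trans (cong (f x + g x +_) (sum-map-+ f g xs)) (interchange (f x) (g x) (sum (map f xs)) _)

sum-map-*ˡ : ∀ a (f : A → ℕ) (xs : List A) → sum (map (λ x → a * f x) xs) ≡ a * sum (map f xs)
sum-map-*ˡ a f []       = sym (*-zeroʳ a)
sum-map-*ˡ a f (x ∷ xs) =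
  trans (cong (a * f x +_) (sum-map-*ˡ a f xs)) (sym (*-distribˡ-+ a (f x) _))

sum-map-*ʳ : ∀ a (f : A → ℕ) (xs : List A) → sum (map (λ x → f x * a) xs) ≡ sum (map f xs) * a
sum-map-*ʳ a f xs = begin
  sum (map (λ x → f x * a) xs) ≡⟨ cong sum (map-cong (λ x → *-comm (f x) a) xs) ⟩
  sum (map (λ x → a * f x) xs) ≡⟨ sum-map-*ˡ a f xs ⟩
  a * sum (map f xs)           ≡⟨ *-comm a _ ⟩
  sum (map f xs) * a           ∎

sum-map-swap : (f : A → B → ℕ) (xs : List A) (ys : List B) →
               sum (map (λ x → sum (map (f x) ys)) xs) ≡ sum (map (λ y → sum (map (λ x → f x y) xs)) ys)
sum-map-swap f []       ys = sym (sum-map-zero ys)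
sum-map-swap f (x ∷ xs) ys =
  trans (cong (sum (map (f x) ys) +_) (sum-map-swap f xs ys)) (sym (sum-map-+ (f x) _ ys))

sum-map-concatMap : (g : B → ℕ) (f : A → List B) (xs : List A) →
                    sum (map g (concatMap f xs)) ≡ sum (map (λ x → sum (map g (f x))) xs)
sum-map-concatMap g f []       = refl
sum-map-concatMap g f (x ∷ xs) = begin
  sum (map g (f x ++ concatMap f xs))
    ≡⟨ cong sum (map-++ g (f x) _) ⟩
  sum (map g (f x) ++ map g (concatMap f xs))
    ≡⟨ sum-++ (map g (f x)) _ ⟩
  sum (map g (f x)) + sum (map g (concatMap f xs))
    ≡⟨ cong (sum (map g (f x)) +_) (sum-map-concatMap g f xs) ⟩
  sum (map g (f x)) + sum (map (λ x → sum (map g (f x))) xs) ∎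

length-filter-sum : {P : A → Set} (P? : ∀ x → Dec (P x)) (xs : List A) →
                    length (filter P? xs) ≡ sum (map (λ x → ⟦ P? x ⟧) xs)
length-filter-sum P? []       = refl
length-filter-sum P? (x ∷ xs) with does (P? x)
... | true  = cong suc (length-filter-sum P? xs)
... | false = length-filter-sum P? xs

sum-map-filter : {P : A → Set} (P? : ∀ x → Dec (P x)) (f : A → ℕ) (xs : List A) →
                 sum (map f (filter P? xs)) ≡ sum (map (λ x → ⟦ P? x ⟧ * f x) xs)
sum-map-filter P? f []       = refl
sum-map-filter P? f (x ∷ xs) with does (P? x)
... | true  = cong₂ _+_ (sym (+-identityʳ (f x))) (sum-map-filter P? f xs)
... | false = sum-map-filter P? f xs

∑< : ℕ → (ℕ → ℕ) → ℕ
∑< n f = sum (map f (upTo n))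

syntax ∑< n (λ m → e) = ∑[ m < n ] e

∑-cong : ∀ n {f g : ℕ → ℕ} → (∀ m → f m ≡ g m) → ∑< n f ≡ ∑< n g
∑-cong n f≗g = cong sum (map-cong f≗g (upTo n))

∑-suc : ∀ n (f : ℕ → ℕ) → ∑[ m < suc n ] f m ≡ f 0 + ∑[ m < n ] f (suc m)
∑-suc n f = cong (λ xs → f 0 + sum xs)
  (trans (map-applyUpTo suc f n) (sym (map-upTo (f ∘ suc) n)))

∑-last : ∀ n (f : ℕ → ℕ) → ∑[ m < suc n ] f m ≡ ∑[ m < n ] f m + f n
∑-last n f = begin
  sum (map f (upTo (suc n)))             ≡⟨ cong (sum ∘ map f) (upTo-∷ʳ n) ⟨
  sum (map f (upTo n ++ n ∷ []))         ≡⟨ cong sum (map-++ f (upTo n) _) ⟩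
  sum (map f (upTo n) ++ f n ∷ [])       ≡⟨ sum-++ (map f (upTo n)) _ ⟩
  sum (map f (upTo n)) + (f n + 0)       ≡⟨ cong (sum (map f (upTo n)) +_) (+-identityʳ (f n)) ⟩
  sum (map f (upTo n)) + f n             ∎

∑-drop : ∀ a n (f : ℕ → ℕ) → (∀ m → m < a → f m ≡ 0) → ∑[ m < n ] f m ≡ ∑[ i < n ∸ a ] f (a + i)
∑-drop zero    n       f f<a≡0 = refl
∑-drop (suc a) zero    f f<a≡0 = refl
∑-drop (suc a) (suc n) f f<a≡0 = begin
  ∑[ m < suc n ] f m         ≡⟨ ∑-suc n f ⟩
  f 0 + ∑[ m < n ] f (suc m) ≡⟨ cong (_+ ∑[ m < n ] f (suc m)) (f<a≡0 0 (s≤s z≤n)) ⟩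
  ∑[ m < n ] f (suc m)       ≡⟨ ∑-drop a n (f ∘ suc) (λ m m<a → f<a≡0 (suc m) (s≤s m<a)) ⟩
  ∑[ i < n ∸ a ] f (suc (a + i)) ∎

-- Nonnegative walks

neighbours : ℕ → List ℕ
neighbours zero    = 1 ∷ 0 ∷ []
neighbours (suc h) = suc (suc h) ∷ h ∷ suc h ∷ []

step : (ℕ → ℕ) → ℕ → ℕ
step f h = sum (map f (neighbours h))

step-cong : ∀ {f g : ℕ → ℕ} → (∀ h → f h ≡ g h) → ∀ h → step f h ≡ step g h
step-cong f≗g h = cong sum (map-cong f≗g (neighbours h))

step-vanish : ∀ {f : ℕ → ℕ} h → (∀ h′ → h′ ≤ suc h → f h′ ≡ 0) → step f h ≡ 0
step-vanish zero    f≡0 rewrite f≡0 1 ≤-refl | f≡0 0 z≤n = refl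
step-vanish (suc h) f≡0
  rewrite f≡0 (suc (suc h)) ≤-refl | f≡0 h (m≤n⇒m≤1+n (n≤1+n h)) | f≡0 (suc h) (n≤1+n (suc h)) = refl

step-δ : ∀ h k → step (λ h′ → δ h′ k) h ≡ step (δ h) k
step-δ zero    zero    = refl
step-δ zero    (suc k) = refl
step-δ (suc h) zero    = refl
step-δ (suc h) (suc k) = x∙yz≈y∙xz (δ (suc h) k) (δ h (suc k)) (δ h k + 0)

walks : ℕ → ℕ → ℕ → ℕ
walks h zero    k = δ h k
walks h (suc n) k = step (λ h′ → walks h′ n k) h

walks-sucʳ : ∀ h n k → walks h (suc n) k ≡ step (walks h n) k
walks-sucʳ h zero    k = step-δ h k
walks-sucʳ h (suc n) k = begin
  step (λ h′ → walks h′ (suc n) k) h            ≡⟨ step-cong (λ h′ → walks-sucʳ h′ n k) h ⟩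
  step (λ h′ → step (walks h′ n) k) h           ≡⟨ sum-map-swap (λ h′ k′ → walks h′ n k′) (neighbours h) (neighbours k) ⟩
  step (λ k′ → step (λ h′ → walks h′ n k′) h) k ∎

walks-sym : ∀ h n k → walks h n k ≡ walks k n h
walks-sym h zero    k = δ-sym h k
walks-sym h (suc n) k = begin
  step (λ h′ → walks h′ n k) h ≡⟨ step-cong (λ h′ → walks-sym h′ n k) h ⟩
  step (walks k n) h           ≡⟨ walks-sucʳ k n h ⟨
  walks k (suc n) h            ∎

walks-vanish : ∀ h n k → h + n < k → walks h n k ≡ 0
walks-vanish h zero    k h+0<k = δ-≢ h k (<⇒≢ (subst (_< k) (+-identityʳ h) h+0<k))
walks-vanish h (suc n) k h+n<k = step-vanish h (λ h′ h′≤1+h → walks-vanish h′ n k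
  (≤-<-trans (+-monoˡ-≤ n h′≤1+h) (subst (_< k) (+-suc h n) h+n<k)))

-- The flat steps at height e + 1 cancel: only the arrivals from e + 2 and from e remain.
walks-telescope : ∀ h n e →
  walks h n (suc e) ≡ δ h (suc e) + ∑[ j < n ] (walks h j (suc (suc e)) + walks h j e)
walks-telescope h zero    e = sym (+-identityʳ _)
walks-telescope h (suc n) e = begin
  walks h (suc n) (suc e)                         ≡⟨ walks-sucʳ h n (suc e) ⟩
  above + (below + (walks h n (suc e) + 0))       ≡⟨ cong (λ x → above + (below + x)) (+-identityʳ _) ⟩
  above + (below + walks h n (suc e))             ≡⟨ cong (λ x → above + (below + x)) (walks-telescope h n e) ⟩
  above + (below + (δ h (suc e) + earlier))       ≡⟨ x∙yz≈z∙xy above below _ ⟩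
  (δ h (suc e) + earlier) + (above + below)       ≡⟨ +-assoc (δ h (suc e)) earlier _ ⟩
  δ h (suc e) + (earlier + (above + below))       ≡⟨ cong (δ h (suc e) +_) (∑-last n _) ⟨
  δ h (suc e) + ∑[ j < suc n ] (walks h j (suc (suc e)) + walks h j e) ∎
  where
  above below earlier : ℕ
  above   = walks h n (suc (suc e))
  below   = walks h n e
  earlier = ∑[ j < n ] (walks h j (suc (suc e)) + walks h j e)

-- Cauchy products and the Duhamel principle

_⋆_ : (ℕ → ℕ) → (ℕ → ℕ) → ℕ → ℕ
(u ⋆ v) zero    = u 0 * v 0
(u ⋆ v) (suc n) = u 0 * v (suc n) + ((u ∘ suc) ⋆ v) n

⋆-cong : ∀ n {u u′ v v′ : ℕ → ℕ} → (∀ a → u a ≡ u′ a) → (∀ b → v b ≡ v′ b) → (u ⋆ v) n ≡ (u′ ⋆ v′) n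
⋆-cong zero    u≗u′ v≗v′ = cong₂ _*_ (u≗u′ 0) (v≗v′ 0)
⋆-cong (suc n) u≗u′ v≗v′ =
  cong₂ _+_ (cong₂ _*_ (u≗u′ 0) (v≗v′ (suc n))) (⋆-cong n (u≗u′ ∘ suc) v≗v′)

sum-map-⋆ : ∀ n (u : A → ℕ → ℕ) (v : ℕ → ℕ) (xs : List A) →
            sum (map (λ x → (u x ⋆ v) n) xs) ≡ ((λ a → sum (map (λ x → u x a) xs)) ⋆ v) n
sum-map-⋆ zero    u v xs = sum-map-*ʳ (v 0) (λ x → u x 0) xs
sum-map-⋆ (suc n) u v xs = trans (sum-map-+ (λ x → u x 0 * v (suc n)) (λ x → ((u x ∘ suc) ⋆ v) n) xs)
  (cong₂ _+_ (sum-map-*ʳ (v (suc n)) (λ x → u x 0) xs) (sum-map-⋆ n (λ x → u x ∘ suc) v xs))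

⋆-∑ : ∀ n (u v : ℕ → ℕ) → (u ⋆ (λ b → ∑[ m < b ] v m)) n ≡ ∑[ m < n ] (u ⋆ v) m
⋆-∑ zero    u v = *-zeroʳ (u 0)
⋆-∑ (suc n) u v = begin
  u 0 * ∑[ m < suc n ] v m + ((u ∘ suc) ⋆ (λ b → ∑[ m < b ] v m)) n
    ≡⟨ cong₂ _+_ (cong (u 0 *_) (∑-suc n v)) (⋆-∑ n (u ∘ suc) v) ⟩
  u 0 * (v 0 + ∑[ m < n ] v (suc m)) + ∑[ m < n ] ((u ∘ suc) ⋆ v) m
    ≡⟨ cong (_+ ∑[ m < n ] ((u ∘ suc) ⋆ v) m) (*-distribˡ-+ (u 0) (v 0) _) ⟩
  u 0 * v 0 + u 0 * ∑[ m < n ] v (suc m) + ∑[ m < n ] ((u ∘ suc) ⋆ v) m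
    ≡⟨ +-assoc (u 0 * v 0) _ _ ⟩
  u 0 * v 0 + (u 0 * ∑[ m < n ] v (suc m) + ∑[ m < n ] ((u ∘ suc) ⋆ v) m)
    ≡⟨ cong (u 0 * v 0 +_) (cong (_+ ∑[ m < n ] ((u ∘ suc) ⋆ v) m) (sum-map-*ˡ (u 0) (v ∘ suc) (upTo n))) ⟨
  u 0 * v 0 + (∑[ m < n ] (u 0 * v (suc m)) + ∑[ m < n ] ((u ∘ suc) ⋆ v) m)
    ≡⟨ cong (u 0 * v 0 +_) (sum-map-+ (λ m → u 0 * v (suc m)) (λ m → ((u ∘ suc) ⋆ v) m) (upTo n)) ⟨
  u 0 * v 0 + ∑[ m < n ] (u ⋆ v) (suc m)
    ≡⟨ ∑-suc n (u ⋆ v) ⟨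
  ∑[ m < suc n ] (u ⋆ v) m ∎

-- A source σ injected at height g is propagated by walks.
duhamel : ∀ g (σ : ℕ → ℕ) (f : ℕ → ℕ → ℕ) →
          (∀ h → f h 0 ≡ 0) →
          (∀ h n → f h (suc n) ≡ step (λ h′ → f h′ n) h + δ h g * σ n) →
          ∀ n h → f h (suc n) ≡ ((λ a → walks h a g) ⋆ σ) n
duhamel g σ f f₀ fₛ zero h = begin
  f h 1                                  ≡⟨ fₛ h 0 ⟩
  step (λ h′ → f h′ 0) h + δ h g * σ 0   ≡⟨ cong (_+ δ h g * σ 0) (step-cong f₀ h) ⟩
  step (λ _ → 0) h + δ h g * σ 0         ≡⟨ cong (_+ δ h g * σ 0) (sum-map-zero (neighbours h)) ⟩
  δ h g * σ 0                            ∎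
duhamel g σ f f₀ fₛ (suc n) h = begin
  f h (suc (suc n))
    ≡⟨ fₛ h (suc n) ⟩
  step (λ h′ → f h′ (suc n)) h + δ h g * σ (suc n)
    ≡⟨ cong (_+ δ h g * σ (suc n)) (step-cong (duhamel g σ f f₀ fₛ n) h) ⟩
  step (λ h′ → ((λ a → walks h′ a g) ⋆ σ) n) h + δ h g * σ (suc n)
    ≡⟨ cong (_+ δ h g * σ (suc n)) (sum-map-⋆ n (λ h′ a → walks h′ a g) σ (neighbours h)) ⟩
  ((λ a → walks h (suc a) g) ⋆ σ) n + δ h g * σ (suc n)
    ≡⟨ +-comm _ (δ h g * σ (suc n)) ⟩
  ((λ a → walks h a g) ⋆ σ) (suc n) ∎

-- Cut a walk from g + c + 1 down to 0 at its first step from height c + 1 to c.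
walks-first-passage : ∀ c n g →
  walks (suc (g + c)) (suc n) 0 ≡ ((λ a → walks g a 0) ⋆ (λ b → walks c b 0)) n
walks-first-passage c =
  duhamel 0 (λ b → walks c b 0) (λ g n → walks (suc (g + c)) n 0) (λ _ → refl) recurrence
  where
  recurrence : ∀ g n → walks (suc (g + c)) (suc n) 0
                     ≡ step (λ g′ → walks (suc (g′ + c)) n 0) g + δ g 0 * walks c n 0
  recurrence zero    n = begin
    above + (cross + (level + 0))  ≡⟨ x∙yz≈xz∙y above cross (level + 0) ⟩
    above + (level + 0) + cross     ≡⟨ cong (above + (level + 0) +_) (+-identityʳ cross) ⟨
    above + (level + 0) + (cross + 0) ∎
    where
    above cross level : ℕ
    above = walks (suc (suc c)) n 0
    cross = walks c n 0
    level = walks (suc c) n 0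
  recurrence (suc g) n = sym (+-identityʳ _)

-- Counting words

extend : List Step → List (List Step)
extend w = (U ∷ w) ∷ (D ∷ w) ∷ (F ∷ w) ∷ []

sumWords : ℕ → (List Step → ℕ) → ℕ
sumWords n g = sum (map g (words n))

sumWords-suc : ∀ n (g : List Step → ℕ) → sumWords (suc n) g ≡ sumWords n (λ w → sum (map g (extend w)))
sumWords-suc n g = sum-map-concatMap g extend (words n)

reaches : ℕ → ℕ → List Step → ℕ
reaches h k w = ⟦ ≡-dec _≟_ (walk h w) (just k) ⟧

reaches-extend : ∀ h k w → sum (map (reaches h k) (extend w)) ≡ step (λ h′ → reaches h′ k w) h
reaches-extend zero    k w = refl
reaches-extend (suc h) k w = refl

sumWords-reaches : ∀ n h k → sumWords n (reaches h k) ≡ walks h n k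
sumWords-reaches zero    h k = +-identityʳ (δ h k)
sumWords-reaches (suc n) h k = begin
  sumWords (suc n) (reaches h k)
    ≡⟨ sumWords-suc n (reaches h k) ⟩
  sumWords n (λ w → sum (map (reaches h k) (extend w)))
    ≡⟨ cong sum (map-cong (reaches-extend h k) (words n)) ⟩
  sumWords n (λ w → step (λ h′ → reaches h′ k w) h)
    ≡⟨ sum-map-swap (λ w h′ → reaches h′ k w) (words n) (neighbours h) ⟩
  step (λ h′ → sumWords n (reaches h′ k)) h
    ≡⟨ step-cong (λ h′ → sumWords-reaches n h′ k) h ⟩
  walks h (suc n) k ∎

MP≡walks : ∀ n k → MP n k ≡ walks 0 n k
MP≡walks n k = trans (length-filter-sum _ (words n)) (sumWords-reaches n 0 k)

-- Counting humps

count-∷ : ∀ k x xs → count k (x ∷ xs) ≡ δ x k + count k xs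
count-∷ k x xs with x ≡ᵇ k
... | true  = refl
... | false = refl

humpWeight : ℕ → ℕ → List Step → ℕ
humpWeight h k w = reaches h 0 w * count k (humps h w)

-- What may follow the up step of a hump at height h: flat steps, a down step, then a walk to 0.
closingWeight : ℕ → List Step → ℕ
closingWeight h w = if closes w then reaches h 0 w else 0

humpWeight-U : ∀ h k w →
  humpWeight h k (U ∷ w) ≡ humpWeight (suc h) k w + δ (suc h) k * closingWeight (suc h) w
humpWeight-U h k w with closes w
... | true  = begin
  r * count k (suc h ∷ humps (suc h) w) ≡⟨ cong (r *_) (count-∷ k (suc h) (humps (suc h) w)) ⟩
  r * (δ (suc h) k + c)                 ≡⟨ *-distribˡ-+ r (δ (suc h) k) c ⟩
  r * δ (suc h) k + r * c               ≡⟨ +-comm (r * δ (suc h) k) (r * c) ⟩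
  r * c + r * δ (suc h) k               ≡⟨ cong (r * c +_) (*-comm r (δ (suc h) k)) ⟩
  r * c + δ (suc h) k * r               ∎
  where
  r c : ℕ
  r = reaches (suc h) 0 w
  c = count k (humps (suc h) w)
... | false = sym (trans (cong (humpWeight (suc h) k w +_) (*-zeroʳ (δ (suc h) k))) (+-identityʳ _))

humpWeight-extend : ∀ h k w → sum (map (humpWeight h k) (extend w))
                            ≡ step (λ h′ → humpWeight h′ k w) h + δ (suc h) k * closingWeight (suc h) w
humpWeight-extend zero    k w = trans (cong (_+ (humpWeight 0 k w + 0)) (humpWeight-U 0 k w))
  (xy∙z≈xz∙y (humpWeight 1 k w) _ (humpWeight 0 k w + 0))
humpWeight-extend (suc h) k w = trans (cong (_+ rest) (humpWeight-U (suc h) k w))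
  (xy∙z≈xz∙y (humpWeight (suc (suc h)) k w) _ rest)
  where
  rest : ℕ
  rest = humpWeight h k w + (humpWeight (suc h) k w + 0)

humpTotal : ℕ → ℕ → ℕ → ℕ
humpTotal h n k = sumWords n (humpWeight h k)

closingTotal : ℕ → ℕ → ℕ
closingTotal h n = sumWords n (closingWeight h)

HM≡humpTotal : ∀ n k → HM n k ≡ humpTotal 0 n k
HM≡humpTotal n k = sum-map-filter _ _ (words n)

closingTotal-∑ : ∀ g n → closingTotal (suc g) n ≡ ∑[ m < n ] walks g m 0
closingTotal-∑ g zero    = refl
closingTotal-∑ g (suc n) = begin
  closingTotal (suc g) (suc n)
    ≡⟨ sumWords-suc n (closingWeight (suc g)) ⟩
  sumWords n (λ w → reaches g 0 w + (closingWeight (suc g) w + 0))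
    ≡⟨ cong sum (map-cong (λ w → cong (reaches g 0 w +_) (+-identityʳ _)) (words n)) ⟩
  sumWords n (λ w → reaches g 0 w + closingWeight (suc g) w)
    ≡⟨ sum-map-+ (reaches g 0) (closingWeight (suc g)) (words n) ⟩
  sumWords n (reaches g 0) + closingTotal (suc g) n
    ≡⟨ cong₂ _+_ (sumWords-reaches n g 0) (closingTotal-∑ g n) ⟩
  walks g n 0 + ∑[ m < n ] walks g m 0
    ≡⟨ +-comm (walks g n 0) _ ⟩
  ∑[ m < n ] walks g m 0 + walks g n 0
    ≡⟨ ∑-last n (λ m → walks g m 0) ⟨
  ∑[ m < suc n ] walks g m 0 ∎

humpTotal-suc : ∀ h n k → humpTotal h (suc n) k
                        ≡ step (λ h′ → humpTotal h′ n k) h + δ (suc h) k * closingTotal (suc h) n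
humpTotal-suc h n k = begin
  humpTotal h (suc n) k
    ≡⟨ sumWords-suc n (humpWeight h k) ⟩
  sumWords n (λ w → sum (map (humpWeight h k) (extend w)))
    ≡⟨ cong sum (map-cong (humpWeight-extend h k) (words n)) ⟩
  sumWords n (λ w → step (λ h′ → humpWeight h′ k w) h + δ (suc h) k * closingWeight (suc h) w)
    ≡⟨ sum-map-+ _ _ (words n) ⟩
  sumWords n (λ w → step (λ h′ → humpWeight h′ k w) h) + sumWords n (λ w → δ (suc h) k * closingWeight (suc h) w)
    ≡⟨ cong₂ _+_ (sum-map-swap (λ w h′ → humpWeight h′ k w) (words n) (neighbours h))
                 (sum-map-*ˡ (δ (suc h) k) (closingWeight (suc h)) (words n)) ⟩
  step (λ h′ → humpTotal h′ n k) h + δ (suc h) k * closingTotal (suc h) n ∎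

humpTotal-⋆ : ∀ c n h → humpTotal h (suc n) (suc c) ≡ ((λ a → walks h a c) ⋆ closingTotal (suc c)) n
humpTotal-⋆ c = duhamel c (closingTotal (suc c)) (λ h n → humpTotal h n (suc c))
  (λ h → trans (+-identityʳ _) (*-zeroʳ (δ h 0)))
  (λ h n → trans (humpTotal-suc h n (suc c))
    (cong (step (λ h′ → humpTotal h′ n (suc c)) h +_) (δ-subst (suc h) (suc c) (λ g → closingTotal g n))))

HM-∑ : ∀ n c → HM n (suc c) ≡ ∑[ m < n ] walks 0 m (suc (c + c))
HM-∑ zero    c = refl
HM-∑ (suc n) c = begin
  HM (suc n) (suc c)
    ≡⟨ HM≡humpTotal (suc n) (suc c) ⟩
  humpTotal 0 (suc n) (suc c)
    ≡⟨ humpTotal-⋆ c n 0 ⟩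
  ((λ a → walks 0 a c) ⋆ closingTotal (suc c)) n
    ≡⟨ ⋆-cong n (λ a → walks-sym 0 a c) (closingTotal-∑ c) ⟩
  ((λ a → walks c a 0) ⋆ (λ b → ∑[ m < b ] walks c m 0)) n
    ≡⟨ ⋆-∑ n (λ a → walks c a 0) (λ b → walks c b 0) ⟩
  ∑[ m < n ] ((λ a → walks c a 0) ⋆ (λ b → walks c b 0)) m
    ≡⟨ ∑-cong n (λ m → walks-first-passage c m c) ⟨
  ∑[ m < n ] walks (suc (c + c)) (suc m) 0
    ≡⟨ ∑-cong n (λ m → walks-sym (suc (c + c)) (suc m) 0) ⟩
  ∑[ m < n ] walks 0 (suc m) (suc (c + c))
    ≡⟨ ∑-suc n (λ m → walks 0 m (suc (c + c))) ⟨
  ∑[ m < suc n ] walks 0 m (suc (c + c)) ∎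

HM-sumFromTo : ∀ n c → HM (suc n) (suc c) ≡ sumFromTo (suc (c + c)) n (λ m → MP m (suc (c + c)))
HM-sumFromTo n c = begin
  HM (suc n) (suc c)                     ≡⟨ HM-∑ (suc n) c ⟩
  ∑[ m < suc n ] walks 0 m (suc (c + c)) ≡⟨ ∑-cong (suc n) (λ m → MP≡walks m (suc (c + c))) ⟨
  ∑[ m < suc n ] MP m (suc (c + c))      ≡⟨ ∑-drop (suc (c + c)) (suc n) _ MP-vanish ⟩
  sumFromTo (suc (c + c)) n (λ m → MP m (suc (c + c))) ∎
  where
  MP-vanish : ∀ m → m < suc (c + c) → MP m (suc (c + c)) ≡ 0
  MP-vanish m m<k = trans (MP≡walks m _) (walks-vanish 0 m _ m<k)

MP-even : ∀ n c → MP n (suc (suc (c + c))) ≡ HM n (suc c) + HM n (suc (suc c))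
MP-even n c = begin
  MP n (suc (suc (c + c)))
    ≡⟨ MP≡walks n _ ⟩
  walks 0 n (suc (suc (c + c)))
    ≡⟨ walks-telescope 0 n (suc (c + c)) ⟩
  ∑[ j < n ] (walks 0 j (suc (suc (suc (c + c)))) + walks 0 j (suc (c + c)))
    ≡⟨ sum-map-+ _ _ (upTo n) ⟩
  ∑[ j < n ] walks 0 j (suc (suc (suc (c + c)))) + ∑[ j < n ] walks 0 j (suc (c + c))
    ≡⟨ +-comm (∑[ j < n ] walks 0 j (suc (suc (suc (c + c))))) _ ⟩
  ∑[ j < n ] walks 0 j (suc (c + c)) + ∑[ j < n ] walks 0 j (suc (suc (suc (c + c))))
    ≡⟨ cong₂ _+_ (HM-∑ n c) (trans (HM-∑ n (suc c)) (∑-cong n (λ j → cong (walks 0 j ∘ suc ∘ suc) (+-suc c c)))) ⟨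
  HM n (suc c) + HM n (suc (suc c)) ∎

2*[1+c]∸1≡1+c+c : ∀ c → 2 * suc c ∸ 1 ≡ suc (c + c)
2*[1+c]∸1≡1+c+c c = trans (+-suc c (c + 0)) (cong (suc ∘ (c +_)) (+-identityʳ c))

corollary2p2 : (n k : ℕ) → 2 ≤ n → 1 ≤ k →
    (HM n k ≡ sumFromTo (2 * k ∸ 1) (n ∸ 1) (λ m → MP m (2 * k ∸ 1)))
    × (MP n (2 * k) ≡ HM n k + HM n (k + 1))
corollary2p2 (suc n) (suc c) (s≤s _) (s≤s _) = hump-formula , prefix-formula
  where
  hump-formula : HM (suc n) (suc c) ≡ sumFromTo (2 * suc c ∸ 1) n (λ m → MP m (2 * suc c ∸ 1))
  hump-formula = subst (λ k → HM (suc n) (suc c) ≡ sumFromTo k n (λ m → MP m k))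
                       (sym (2*[1+c]∸1≡1+c+c c)) (HM-sumFromTo n c)

  prefix-formula : MP (suc n) (2 * suc c) ≡ HM (suc n) (suc c) + HM (suc n) (suc c + 1)
  prefix-formula = subst₂ (λ k k′ → MP (suc n) k ≡ HM (suc n) (suc c) + HM (suc n) k′)
                          (sym (cong suc (2*[1+c]∸1≡1+c+c c))) (+-comm 1 (suc c)) (MP-even (suc n) c)
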